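{- For every prime $p\ge 3$ there exists a digraph $\mathbb{H}$ with $p$ vertices that admits idempotent totally symmetric polymorphisms of every arity $k$ with $k<p$, but admits no totally symmetric (indeed, no cyclic) polymorphism of arity $p$.
   Context: A digraph is a relational structure with one binary relation (the arcs). A $k$-ary operation $f$ on the vertex set is a polymorphism if whenever $(u_i,v_i)$ is an arc for each $i=1,\dots,k$, then $(f(u_1,\dots,u_k),f(v_1,\dots,v_k))$ is an arc. $f$ is idempotent if $f(x,\dots,x)=x$; totally symmetric if $f(x_1,\dots,x_k)=f(y_1,\dots,y_k)$ whenever $\{x_1,\dots,x_k\}=\{y_1,\dots,y_k\}$; cyclic if $f(x_1,\dots,x_k)=f(x_k,x_1,\dots,x_{k-1})$. -}

module Defs where

open import Data.Nat using (ℕ; zero; suc)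
open import Data.Fin using (Fin; zero; suc; fromℕ; inject₁)
open import Data.Product using (∃)
open import Relation.Binary.PropositionalEquality using (_≡_)

Digraph : ℕ → Set₁
Digraph n = Fin n → Fin n → Set

Op : ℕ → ℕ → Set
Op n k = (Fin k → Fin n) → Fin n

IsPolymorphism : ∀ {n k} → Digraph n → Op n k → Set
IsPolymorphism {n} {k} H f =
  (u v : Fin k → Fin n) → (∀ i → H (u i) (v i)) → H (f u) (f v)

IsIdempotent : ∀ {n k} → Op n k → Set
IsIdempotent {n} {k} f = (x : Fin n) → f (λ _ → x) ≡ x

SameSet : ∀ {n k} → (Fin k → Fin n) → (Fin k → Fin n) → Set
SameSet x y = (∀ i → ∃ λ j → x i ≡ y j) × (∀ j → ∃ λ i → y j ≡ x i)
  where open import Data.Product using (_×_)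

IsTotallySymmetric : ∀ {n k} → Op n k → Set
IsTotallySymmetric {n} {k} f =
  (x y : Fin k → Fin n) → SameSet x y → f x ≡ f y

rotate : ∀ {n k} → (Fin k → Fin n) → Fin k → Fin n
rotate {k = zero} x ()
rotate {k = suc m} x zero = x (fromℕ m)
rotate {k = suc m} x (suc i) = x (inject₁ i)

IsCyclic : ∀ {n k} → Op n k → Set
IsCyclic {n} {k} f = (x : Fin k → Fin n) → f x ≡ f (rotate x)

-- The digraph is the directed p-cycle a → a + 1 on ℤ/p. Sending a tuple to the average of its
-- distinct entries, i.e. (sum of the entries) / (number of entries) in ℤ/p, is well defined
-- when fewer than p entries are given (p is prime), clearly totally symmetric and idempotent,
-- and a polymorphism: shifting every entry by 1 shifts the average by 1. For arity p, a cyclic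
-- polymorphism f would give an arc from f(p−1, 0, …, p−2) to f(0, 1, …, p−1), i.e. a loop.

module Submission where

open import Defs
open import Data.Nat using (ℕ; _≤_; _<_)
open import Data.Nat.Primality using (Prime)
open import Data.Product using (Σ; _×_)
open import Relation.Nullary using (¬_)

open import Data.Nat using (zero; suc; _+_; _*_; _%_; z≤n; s≤s; s≤s⁻¹; NonZero)
open import Data.Nat.Properties
open import Data.Nat.DivMod
open import Data.Nat.Coprimality using (prime⇒coprime; coprime-Bézout)
open import Data.Nat.GCD using (module Bézout)
open import Data.Nat.Solver using (module +-*-Solver)
import Data.Fin as Fin
open import Data.Fin using (Fin; toℕ; fromℕ; inject₁; lower₁)
open import Data.Fin.Properties
  using (any?; all?; ¬∀⟶∃¬; injective⇒≤; toℕ-injective; toℕ<n; toℕ-fromℕ; toℕ-fromℕ<; toℕ-inject₁; inject₁-lower₁)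
open import Data.Product using (_,_; proj₁; proj₂; ∃)
open import Data.Sum using (inj₁; inj₂)
open import Function using (_∘_; id)
open import Relation.Nullary using (Dec; yes; no; contradiction)
open import Relation.Binary.PropositionalEquality

open +-*-Solver using (solve; _:+_; _:*_; _:=_; con)

sum< : ℕ → (ℕ → ℕ) → ℕ
sum< zero    g = 0
sum< (suc n) g = sum< n g + g n

syntax sum< n (λ z → e) = ∑[ z < n ] e

module _ {g h : ℕ → ℕ} where

  sum<-cong : ∀ n → (∀ z → z < n → g z ≡ h z) → sum< n g ≡ sum< n h
  sum<-cong zero    _  = refl
  sum<-cong (suc n) eq = cong₂ _+_ (sum<-cong n (λ z → eq z ∘ m<n⇒m<1+n)) (eq n (n<1+n n))

  sum<-+ : ∀ n → ∑[ z < n ] (g z + h z) ≡ sum< n g + sum< n h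
  sum<-+ zero    = refl
  sum<-+ (suc n) = trans (cong (_+ (g n + h n)) (sum<-+ n)) (interchange (sum< n g) (sum< n h) (g n) (h n))
    where
    interchange : ∀ a b c d → (a + b) + (c + d) ≡ (a + c) + (b + d)
    interchange = solve 4 (λ a b c d → (a :+ b) :+ (c :+ d) := (a :+ c) :+ (b :+ d)) refl

module _ (g : ℕ → ℕ) where

  sum<-peel : ∀ n → sum< (suc n) g ≡ g 0 + ∑[ z < n ] g (suc z)
  sum<-peel zero    = +-comm 0 (g 0)
  sum<-peel (suc n) = trans (cong (_+ g (suc n)) (sum<-peel n)) (+-assoc (g 0) _ (g (suc n)))

  sum<-rotate : ∀ n → sum< (suc n) g ≡ ∑[ z < suc n ] g (suc z % suc n)
  sum<-rotate n = begin
    sum< (suc n) g                                  ≡⟨ sum<-peel n ⟩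
    g 0 + ∑[ z < n ] g (suc z)                      ≡⟨ +-comm (g 0) _ ⟩
    ∑[ z < n ] g (suc z) + g 0                      ≡⟨ cong₂ _+_ (sum<-cong n (λ z → cong g ∘ m≤n⇒m%n≡m)) (cong g (n%n≡0 (suc n))) ⟨
    ∑[ z < suc n ] g (suc z % suc n)                ∎
    where open ≡-Reasoning

  sum<-≥ : ∀ {n a} → a < n → g a ≤ sum< n g
  sum<-≥ {suc n} a<1+n with m≤n⇒m<n∨m≡n (s≤s⁻¹ a<1+n)
  ... | inj₁ a<n  = ≤-trans (sum<-≥ a<n) (m≤m+n (sum< n g) (g n))
  ... | inj₂ refl = m≤n+m (g n) (sum< n g)

  sum<-zero : ∀ n → (∀ z → z < n → g z ≡ 0) → sum< n g ≡ 0
  sum<-zero zero    _      = refl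
  sum<-zero (suc n) vanish = cong₂ _+_ (sum<-zero n (λ z → vanish z ∘ m<n⇒m<1+n)) (vanish n (n<1+n n))

  sum<-single : ∀ {n a} → a < n → (∀ z → z < n → z ≢ a → g z ≡ 0) → sum< n g ≡ g a
  sum<-single {suc n} a<1+n vanish with m≤n⇒m<n∨m≡n (s≤s⁻¹ a<1+n)
  ... | inj₁ a<n  = trans (cong₂ _+_ (sum<-single a<n (λ z → vanish z ∘ m<n⇒m<1+n))
                                     (vanish n (n<1+n n) (>⇒≢ a<n)))
                          (+-identityʳ _)
  ... | inj₂ refl = cong (_+ g n) (sum<-zero n (λ z z<n → vanish z (m<n⇒m<1+n z<n) (<⇒≢ z<n)))

module _ {g : ℕ → ℕ} (g≤1 : ∀ z → g z ≤ 1) where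

  sum<-≤ : ∀ n → sum< n g ≤ n
  sum<-≤ zero    = z≤n
  sum<-≤ (suc n) = subst (sum< n g + g n ≤_) (+-comm n 1) (+-mono-≤ (sum<-≤ n) (g≤1 n))

  sum<-< : ∀ {n a} → a < n → g a ≡ 0 → sum< n g < n
  sum<-< {suc n} a<1+n ga≡0 with m≤n⇒m<n∨m≡n (s≤s⁻¹ a<1+n)
  ... | inj₁ a<n  = subst (sum< n g + g n <_) (+-comm n 1) (+-mono-<-≤ (sum<-< a<n ga≡0) (g≤1 n))
  ... | inj₂ refl = s≤s (subst (_≤ n) (sym (trans (cong (sum< n g +_) ga≡0) (+-identityʳ _))) (sum<-≤ n))

private variable A B : Set

𝟙 : Dec A → ℕ
𝟙 (yes _) = 1
𝟙 (no _)  = 0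

𝟙-≤1 : (a? : Dec A) → 𝟙 a? ≤ 1
𝟙-≤1 (yes _) = ≤-refl
𝟙-≤1 (no _)  = z≤n

𝟙-yes : A → (a? : Dec A) → 𝟙 a? ≡ 1
𝟙-yes a (yes _) = refl
𝟙-yes a (no ¬a) = contradiction a ¬a

𝟙-no : ¬ A → (a? : Dec A) → 𝟙 a? ≡ 0
𝟙-no ¬a (yes a) = contradiction a ¬a
𝟙-no ¬a (no _)  = refl

𝟙-cong : (A → B) → (B → A) → (a? : Dec A) (b? : Dec B) → 𝟙 a? ≡ 𝟙 b?
𝟙-cong to from (yes a) b? = sym (𝟙-yes (to a) b?)
𝟙-cong to from (no ¬a) b? = sym (𝟙-no (¬a ∘ from) b?)

module _ {n k : ℕ} where

  Occurs : (Fin k → Fin n) → ℕ → Set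
  Occurs u y = ∃ λ i → toℕ (u i) ≡ y

  occurs? : (u : Fin k → Fin n) (y : ℕ) → Dec (Occurs u y)
  occurs? u y = any? (λ i → toℕ (u i) ≟ y)

  χ : (Fin k → Fin n) → ℕ → ℕ
  χ u y = 𝟙 (occurs? u y)

  supportSize : (Fin k → Fin n) → ℕ
  supportSize u = ∑[ y < n ] χ u y

  supportSum : (Fin k → Fin n) → ℕ
  supportSum u = ∑[ y < n ] (χ u y * y)

  χ-≤1 : (u : Fin k → Fin n) (y : ℕ) → χ u y ≤ 1
  χ-≤1 u y = 𝟙-≤1 (occurs? u y)

  sameSet⇒χ≡ : {u v : Fin k → Fin n} → SameSet u v → ∀ y → χ u y ≡ χ v y
  sameSet⇒χ≡ (u⊆v , v⊆u) y = 𝟙-cong (transfer u⊆v) (transfer v⊆u) (occurs? _ y) (occurs? _ y)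
    where
    transfer : ∀ {u v : Fin k → Fin n} → (∀ i → ∃ λ j → u i ≡ v j) → Occurs u y → Occurs v y
    transfer u⊆v (i , eq) = let j , ui≡vj = u⊆v i in j , trans (cong toℕ (sym ui≡vj)) eq

  surjective⇒≤ : (u : Fin k → Fin n) → (∀ y → ∃ λ i → u i ≡ y) → n ≤ k
  surjective⇒≤ u onto = injective⇒≤ section-injective
    where
    section-injective : ∀ {y y′} → proj₁ (onto y) ≡ proj₁ (onto y′) → y ≡ y′
    section-injective {y} {y′} eq = trans (sym (proj₂ (onto y))) (trans (cong u eq) (proj₂ (onto y′)))

  supportSize-< : k < n → (u : Fin k → Fin n) → supportSize u < n
  supportSize-< k<n u with all? (occurs? u ∘ toℕ)
  ... | yes onto = contradiction (surjective⇒≤ u (λ y → let i , eq = onto y in i , toℕ-injective eq)) (<⇒≱ k<n)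
  ... | no ¬onto = let y , y∉u = ¬∀⟶∃¬ n _ (occurs? u ∘ toℕ) ¬onto
                   in sum<-< (χ-≤1 u) (toℕ<n y) (𝟙-no y∉u (occurs? u (toℕ y)))

supportSize-pos : ∀ {n k} (u : Fin (suc k) → Fin n) → 1 ≤ supportSize u
supportSize-pos u = subst (_≤ supportSize u) (𝟙-yes (Fin.zero , refl) (occurs? u _)) (sum<-≥ _ (toℕ<n (u Fin.zero)))

module _ {n k : ℕ} (x : Fin n) where

  private
    χ-const : ∀ y → y ≢ toℕ x → χ {k = suc k} (λ _ → x) y ≡ 0
    χ-const y y≢x = 𝟙-no (λ (_ , eq) → y≢x (sym eq)) (occurs? _ y)

    χ-const-x : χ {k = suc k} (λ _ → x) (toℕ x) ≡ 1
    χ-const-x = 𝟙-yes (Fin.zero , refl) (occurs? _ _)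

  supportSize-const : supportSize {k = suc k} (λ _ → x) ≡ 1
  supportSize-const = trans (sum<-single _ (toℕ<n x) (λ y _ → χ-const y)) χ-const-x

  supportSum-const : supportSum {k = suc k} (λ _ → x) ≡ toℕ x
  supportSum-const = begin
    supportSum {k = suc k} (λ _ → x) ≡⟨ sum<-single _ (toℕ<n x) (λ y _ y≢x → cong (_* y) (χ-const y y≢x)) ⟩
    χ {k = suc k} (λ _ → x) (toℕ x) * toℕ x ≡⟨ cong (_* toℕ x) χ-const-x ⟩
    1 * toℕ x                ≡⟨ *-identityˡ (toℕ x) ⟩
    toℕ x                    ∎
    where open ≡-Reasoning

module Modulo (n : ℕ) .{{_ : NonZero n}} where

  infix 4 _≈_
  _≈_ : ℕ → ℕ → Set
  a ≈ b = a % n ≡ b % n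

  private variable a a′ b b′ k t t′ : ℕ

  %-≈ : ∀ a → a % n ≈ a
  %-≈ a = m%n%n≡m%n a n

  +-≈ : a ≈ a′ → b ≈ b′ → a + b ≈ a′ + b′
  +-≈ {a} {a′} {b} {b′} a≈a′ b≈b′ = begin
    (a + b) % n             ≡⟨ %-distribˡ-+ a b n ⟩
    (a % n + b % n) % n     ≡⟨ cong₂ (λ x y → (x + y) % n) a≈a′ b≈b′ ⟩
    (a′ % n + b′ % n) % n   ≡⟨ %-distribˡ-+ a′ b′ n ⟨
    (a′ + b′) % n           ∎
    where open ≡-Reasoning

  *-≈ : a ≈ a′ → b ≈ b′ → a * b ≈ a′ * b′
  *-≈ {a} {a′} {b} {b′} a≈a′ b≈b′ = begin
    (a * b) % n             ≡⟨ %-distribˡ-* a b n ⟩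
    (a % n * (b % n)) % n   ≡⟨ cong₂ (λ x y → (x * y) % n) a≈a′ b≈b′ ⟩
    (a′ % n * (b′ % n)) % n ≡⟨ %-distribˡ-* a′ b′ n ⟨
    (a′ * b′) % n           ∎
    where open ≡-Reasoning

  sum<-≈ : ∀ m {g h} → (∀ z → z < m → g z ≈ h z) → sum< m g ≈ sum< m h
  sum<-≈ zero    _   = refl
  sum<-≈ (suc m) g≈h = +-≈ (sum<-≈ m (λ z → g≈h z ∘ m<n⇒m<1+n)) (g≈h m (n<1+n m))

  Invertible : ℕ → Set
  Invertible k = ∃ λ (c : Fin n) → toℕ c * k ≈ 1

  invertible : ∀ c → c * k ≈ 1 → Invertible k
  invertible {k} c ck≈1 = c mod n , trans (*-≈ (trans (cong (_% n) (toℕ-fromℕ< _)) (%-≈ c)) refl) ck≈1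

  inverse : ℕ → ℕ
  inverse k with any? (λ (c : Fin n) → toℕ c * k % n ≟ 1 % n)
  ... | yes (c , _) = toℕ c
  ... | no _        = 0

  inverse-* : Invertible k → inverse k * k ≈ 1
  inverse-* {k} invertible-k with any? (λ (c : Fin n) → toℕ c * k % n ≟ 1 % n)
  ... | yes (_ , ck≈1) = ck≈1
  ... | no  none       = contradiction invertible-k none

  -- From Bézout 1 + y k = x n, so y k ≡ -1 and its square y k y k ≡ 1.
  prime⇒invertible : ∀ {k} → Prime n → 0 < k → k < n → Invertible k
  prime⇒invertible {k@(suc _)} n-prime _ k<n with coprime-Bézout (prime⇒coprime n-prime k<n)
  ... | Bézout.-+ x y 1+xn≡yk = invertible y (trans (cong (_% n) (sym 1+xn≡yk)) ([m+kn]%n≡m%n 1 x n))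
  ... | Bézout.+- x y 1+yk≡xn = invertible (y * k * y) (begin
    y * k * y * k % n                     ≡⟨ [m+kn]%n≡m%n (y * k * y * k) (2 * x) n ⟨
    (y * k * y * k + 2 * x * n) % n       ≡⟨ cong (_% n) square ⟩
    (1 + x * x * n * n) % n               ≡⟨ [m+kn]%n≡m%n 1 (x * x * n) n ⟩
    1 % n                                 ∎)
    where
    open ≡-Reasoning
    square : y * k * y * k + 2 * x * n ≡ 1 + x * x * n * n
    square = begin
      y * k * y * k + 2 * x * n             ≡⟨ cong (y * k * y * k +_) (*-assoc 2 x n) ⟩
      y * k * y * k + 2 * (x * n)           ≡⟨ cong (λ w → y * k * y * k + 2 * w) 1+yk≡xn ⟨
      y * k * y * k + 2 * (1 + y * k)       ≡⟨ solve 2 (λ y k → y :* k :* y :* k :+ con 2 :* (con 1 :+ y :* k)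
                                                   := con 1 :+ (con 1 :+ y :* k) :* (con 1 :+ y :* k)) refl y k ⟩
      1 + (1 + y * k) * (1 + y * k)         ≡⟨ cong (λ w → 1 + w * w) 1+yk≡xn ⟩
      1 + x * n * (x * n)                   ≡⟨ solve 2 (λ x n → con 1 :+ x :* n :* (x :* n) := con 1 :+ x :* x :* n :* n) refl x n ⟩
      1 + x * x * n * n                     ∎

  divide : ℕ → ℕ → Fin n
  divide k t = (inverse k * t) mod n

  toℕ-divide : ∀ k t → toℕ (divide k t) ≡ inverse k * t % n
  toℕ-divide k t = toℕ-fromℕ< _

  divide-1 : Invertible 1 → ∀ t → toℕ (divide 1 t) ≡ t % n
  divide-1 invertible-1 t = trans (toℕ-divide 1 t) (trans (*-≈ inverse-1≈1 refl) (cong (_% n) (*-identityˡ t)))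
    where
    inverse-1≈1 : inverse 1 ≈ 1
    inverse-1≈1 = trans (cong (_% n) (sym (*-identityʳ (inverse 1)))) (inverse-* invertible-1)

  divide-+ : Invertible k → t′ ≈ t + k → toℕ (divide k t′) ≡ suc (toℕ (divide k t)) % n
  divide-+ {k} {t′} {t} invertible-k t′≈t+k = begin
    toℕ (divide k t′)             ≡⟨ toℕ-divide k t′ ⟩
    c * t′ % n                    ≡⟨ *-≈ {c} refl t′≈t+k ⟩
    c * (t + k) % n               ≡⟨ cong (_% n) (*-distribˡ-+ c t k) ⟩
    (c * t + c * k) % n           ≡⟨ +-≈ (sym (%-≈ (c * t))) (inverse-* invertible-k) ⟩
    (c * t % n + 1) % n           ≡⟨ cong (λ w → (w + 1) % n) (toℕ-divide k t) ⟨
    (toℕ (divide k t) + 1) % n    ≡⟨ cong (_% n) (+-comm _ 1) ⟩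
    suc (toℕ (divide k t)) % n    ∎
    where
    open ≡-Reasoning
    c = inverse k

rotate-sameSet : ∀ {n k} (x : Fin k → Fin n) → SameSet x (rotate x)
rotate-sameSet {k = zero}  x = (λ ()) , (λ ())
rotate-sameSet {k = suc k} x = x⊆rotate , rotate⊆x
  where
  x⊆rotate : ∀ i → ∃ λ j → x i ≡ rotate x j
  x⊆rotate i with k ≟ toℕ i
  ... | yes k≡i = Fin.zero , cong x (toℕ-injective (trans (sym k≡i) (sym (toℕ-fromℕ k))))
  ... | no  k≢i = Fin.suc (lower₁ i k≢i) , cong x (sym (inject₁-lower₁ i k≢i))
  rotate⊆x : ∀ j → ∃ λ i → rotate x j ≡ x i
  rotate⊆x Fin.zero    = fromℕ k , refl
  rotate⊆x (Fin.suc j) = inject₁ j , refl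

totallySymmetric⇒cyclic : ∀ {n k} {f : Op n k} → IsTotallySymmetric f → IsCyclic f
totallySymmetric⇒cyclic symmetric x = symmetric x (rotate x) (rotate-sameSet x)

cyclic-polymorphism⇒loop : ∀ {n k} {H : Digraph n} {f : Op n k} → IsPolymorphism H f → IsCyclic f →
                           (x : Fin k → Fin n) → (∀ i → H (rotate x i) (x i)) → H (f x) (f x)
cyclic-polymorphism⇒loop {H = H} {f} polymorphism cyclic x arcs =
  subst (λ w → H w (f x)) (sym (cyclic x)) (polymorphism (rotate x) x arcs)

Cycle : ∀ n .{{_ : NonZero n}} → Digraph n
Cycle n a b = toℕ b ≡ suc (toℕ a) % n

suc-%-injective : ∀ {m a b} → a ≤ m → b ≤ m → suc a % suc m ≡ suc b % suc m → a ≡ b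
suc-%-injective {m} a≤m b≤m eq with m≤n⇒m<n∨m≡n a≤m | m≤n⇒m<n∨m≡n b≤m
... | inj₁ a<m  | inj₁ b<m  = suc-injective (trans (sym (m≤n⇒m%n≡m a<m)) (trans eq (m≤n⇒m%n≡m b<m)))
... | inj₁ a<m  | inj₂ refl = contradiction (trans (sym (m≤n⇒m%n≡m a<m)) (trans eq (n%n≡0 (suc m)))) λ ()
... | inj₂ refl | inj₁ b<m  = contradiction (trans (sym (n%n≡0 (suc m))) (trans eq (m≤n⇒m%n≡m b<m))) λ ()
... | inj₂ refl | inj₂ refl = refl

Cycle-irreflexive : ∀ {m} → 1 ≤ m → (a : Fin (suc m)) → ¬ Cycle (suc m) a a
Cycle-irreflexive {m} 1≤m a loop with m≤n⇒m<n∨m≡n (s≤s⁻¹ (toℕ<n a))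
... | inj₁ a<m  = <⇒≢ (n<1+n (toℕ a)) (trans loop (m≤n⇒m%n≡m a<m))
... | inj₂ a≡m  = <⇒≢ 1≤m (sym (begin
  m                     ≡⟨ a≡m ⟨
  toℕ a                 ≡⟨ loop ⟩
  suc (toℕ a) % suc m   ≡⟨ cong (λ w → suc w % suc m) a≡m ⟩
  suc m % suc m         ≡⟨ n%n≡0 (suc m) ⟩
  0                     ∎))
  where open ≡-Reasoning

Cycle-rotate : ∀ {m} (i : Fin (suc m)) → Cycle (suc m) (rotate id i) i
Cycle-rotate {m} Fin.zero    = sym (trans (cong (λ w → suc w % suc m) (toℕ-fromℕ m)) (n%n≡0 (suc m)))
Cycle-rotate {m} (Fin.suc j) = sym (trans (cong (λ w → suc w % suc m) (toℕ-inject₁ j)) (m≤n⇒m%n≡m (toℕ<n j)))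

module Mean (m : ℕ) where

  open Modulo (suc m)

  private variable k : ℕ

  mean : Op (suc m) k
  mean u = divide (supportSize u) (supportSum u)

  mean-totallySymmetric : IsTotallySymmetric (mean {k})
  mean-totallySymmetric u v same =
    cong₂ divide (sum<-cong (suc m) (λ y _ → sameSet⇒χ≡ same y))
                 (sum<-cong (suc m) (λ y _ → cong (_* y) (sameSet⇒χ≡ same y)))

  mean-idempotent : Invertible 1 → IsIdempotent (mean {suc k})
  mean-idempotent invertible-1 x = toℕ-injective (begin
    toℕ (mean (λ _ → x))    ≡⟨ cong₂ (λ s t → toℕ (divide s t)) (supportSize-const x) (supportSum-const x) ⟩
    toℕ (divide 1 (toℕ x))  ≡⟨ divide-1 invertible-1 (toℕ x) ⟩
    toℕ x % suc m           ≡⟨ m<n⇒m%n≡m (toℕ<n x) ⟩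
    toℕ x                   ∎)
    where open ≡-Reasoning

  module _ {u v : Fin k → Fin (suc m)} (arcs : ∀ i → Cycle (suc m) (u i) (v i)) where

    χ-arcs : ∀ z → z < suc m → χ v (suc z % suc m) ≡ χ u z
    χ-arcs z z<n = 𝟙-cong
      (λ (i , vi≡z+1) → i , suc-%-injective (s≤s⁻¹ (toℕ<n (u i))) (s≤s⁻¹ z<n) (trans (sym (arcs i)) vi≡z+1))
      (λ (i , ui≡z) → i , trans (arcs i) (cong (λ w → suc w % suc m) ui≡z))
      (occurs? v _) (occurs? u z)

    supportSize-arcs : supportSize v ≡ supportSize u
    supportSize-arcs = trans (sum<-rotate (χ v) m) (sum<-cong (suc m) χ-arcs)

    supportSum-arcs : supportSum v ≈ supportSum u + supportSize u
    supportSum-arcs = begin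
      supportSum v % suc m
        ≡⟨ cong (_% suc m) (sum<-rotate _ m) ⟩
      (∑[ z < suc m ] (χ v (suc z % suc m) * (suc z % suc m))) % suc m
        ≡⟨ cong (_% suc m) (sum<-cong (suc m) (λ z z<n → cong (_* _) (χ-arcs z z<n))) ⟩
      (∑[ z < suc m ] (χ u z * (suc z % suc m))) % suc m
        ≡⟨ sum<-≈ (suc m) (λ z _ → *-≈ {χ u z} {χ u z} {suc z % suc m} {suc z} refl (%-≈ (suc z))) ⟩
      (∑[ z < suc m ] (χ u z * suc z)) % suc m
        ≡⟨ cong (_% suc m) (sum<-cong (suc m) (λ z _ → trans (*-suc (χ u z) z) (+-comm (χ u z) _))) ⟩
      (∑[ z < suc m ] (χ u z * z + χ u z)) % suc m
        ≡⟨ cong (_% suc m) (sum<-+ (suc m)) ⟩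
      (supportSum u + supportSize u) % suc m
        ∎
      where open ≡-Reasoning

  mean-polymorphism : (∀ (u : Fin k → Fin (suc m)) → Invertible (supportSize u)) →
                      IsPolymorphism (Cycle (suc m)) (mean {k})
  mean-polymorphism invertible u v arcs = begin
    toℕ (divide (supportSize v) (supportSum v)) ≡⟨ cong (λ s → toℕ (divide s (supportSum v))) (supportSize-arcs arcs) ⟩
    toℕ (divide (supportSize u) (supportSum v)) ≡⟨ divide-+ (invertible u) (supportSum-arcs arcs) ⟩
    suc (toℕ (mean u)) % suc m                  ∎
    where open ≡-Reasoning

proposition5p4 : (p : ℕ) → Prime p → 3 ≤ p →
    Σ (Digraph p) λ H →
      ((k : ℕ) → 1 ≤ k → k < p →
        Σ (Op p k) λ f → IsPolymorphism H f × IsIdempotent f × IsTotallySymmetric f)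
      × ¬ (Σ (Op p p) λ f → IsPolymorphism H f × IsTotallySymmetric f)
      × ¬ (Σ (Op p p) λ f → IsPolymorphism H f × IsCyclic f)
proposition5p4 p@(suc m) p-prime 3≤p =
  Cycle p , means , (λ (f , pol , sym) → noCyclic (f , pol , totallySymmetric⇒cyclic sym)) , noCyclic
  where
  open Modulo p
  open Mean m

  1≤m : 1 ≤ m
  1≤m = ≤-trans (s≤s z≤n) (s≤s⁻¹ 3≤p)

  means : (k : ℕ) → 1 ≤ k → k < p →
          Σ (Op p k) λ f → IsPolymorphism (Cycle p) f × IsIdempotent f × IsTotallySymmetric f
  means (suc k) _ k<p =
    mean , mean-polymorphism (λ u → prime⇒invertible p-prime (supportSize-pos u) (supportSize-< k<p u))
         , mean-idempotent (prime⇒invertible p-prime ≤-refl (s≤s 1≤m))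
         , mean-totallySymmetric

  noCyclic : ¬ (Σ (Op p p) λ f → IsPolymorphism (Cycle p) f × IsCyclic f)
  noCyclic (f , polymorphism , cyclic) =
    Cycle-irreflexive 1≤m (f id) (cyclic-polymorphism⇒loop {H = Cycle p} polymorphism cyclic id Cycle-rotate)
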